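{- Let $k$ be a positive integer, $a=12k+8$, $b=a+\frac a2+1$, $c=a+\frac a2+3$ and $S=\{a,b,c\}=\{12k+8,18k+13,18k+15\}$. Then $x\in\langle S\rangle$ if and only if $x=(s+q)a+q\cdot\frac a2+q+2r$ for some $q,r,s\in\mathbb{N}$ with $0\le r\le q$; moreover $\langle S\rangle$ is a $3$-permutation numerical semigroup.
   Context: A numerical semigroup is a submonoid $G$ of $(\mathbb{N},+,0)$ with $\mathbb{N}\setminus G$ finite; $\langle S\rangle$ is the submonoid generated by $S$. Write the elements of $G$ as $0=g_0<g_1<g_2<\cdots$. For $n\ge 1$, $G$ is an $n$-permutation numerical semigroup if $G=\langle g_1,\dots,g_n\rangle$ and for every integer $k\ge 0$ the tuple $(g_{kn+1}\bmod n,\dots,g_{kn+n}\bmod n)$ contains exactly one representative of each residue class of $\mathbb{Z}/n\mathbb{Z}$. -}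

module Defs where

open import Data.Nat using (ℕ; zero; suc; _+_; _*_; _<_; _≤_; NonZero)
open import Data.Nat.DivMod using (_%_)
open import Data.Fin using (Fin; toℕ)
open import Data.List using (List; _∷_; []; tabulate)
open import Data.List.Membership.Propositional using (_∈_)
open import Data.Product using (Σ; ∃; ∃-syntax; _×_; _,_; ∃!)
open import Relation.Binary.PropositionalEquality using (_≡_)
open import Function.Bundles using (_⇔_)

Subsetℕ : Set₁
Subsetℕ = ℕ → Set

data ⟨_⟩ (S : List ℕ) : ℕ → Set where
  gen-zero : ⟨ S ⟩ 0
  gen-add  : ∀ {s x} → s ∈ S → ⟨ S ⟩ x → ⟨ S ⟩ (s + x)

record IsNumericalSemigroup (G : Subsetℕ) : Set where
  field
    has-zero   : G 0
    closed-add : ∀ {x y} → G x → G y → G (x + y)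
    cofinite   : ∃[ N ] (∀ m → N ≤ m → G m)

record Enumerates (G : Subsetℕ) (g : ℕ → ℕ) : Set where
  field
    strictly-increasing : ∀ i → g i < g (suc i)
    image               : ∀ x → G x ⇔ (∃[ i ] g i ≡ x)

IsPermutationNS : (n : ℕ) → .{{NonZero n}} → Subsetℕ → Set
IsPermutationNS n G =
  IsNumericalSemigroup G ×
  Σ (ℕ → ℕ) λ g →
    Enumerates G g ×
    (∀ x → G x ⇔ ⟨ tabulate {n = n} (λ j → g (suc (toℕ j))) ⟩ x) ×
    (∀ (k : ℕ) (r : Fin n) →
       ∃! _≡_ λ (j : Fin n) → g (k * n + suc (toℕ j)) % n ≡ toℕ r)

-- With H = 6k + 5 the generators are a = 2H − 2, b = a + H and c = 3H, so the elements of the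
-- semigroup are the numbers y H + d a with y mod 3 ≤ d; the description by (q, r, s) is a change of
-- coordinates.  Reading ℕ in rows [u H, (u + 1) H), whether u H + w is an element depends only on
-- u mod 3, the parity of w, whether w ∈ {0, H − 2} and a few comparisons of u + w with H and 2H.
-- Scan the elements in increasing order, remembering the residues mod 3 of the current incomplete
-- block of three.  The scan state at u H + w is a function of u mod 6, w mod 6 and the same
-- comparisons, and a finite check over all such abstract positions shows that a block never
-- repeats a residue.  Hence every block of three consecutive elements is a permutation of ℤ/3.
{-# OPTIONS --safe #-}
module Submission where

open import Defs
open import Data.Bool using (Bool; true; false; _∧_; _∨_; not; if_then_else_; T)
open import Data.Bool.Properties using (T-∧; T-∨)
open import Data.Empty using (⊥; ⊥-elim)
open import Data.Fin using (Fin; toℕ; fromℕ<; punchOut) renaming (zero to fzero; suc to fsuc)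
open import Data.Fin.Properties using (toℕ-fromℕ<; punchOut-injective; injective⇒≤; any?)
open import Data.List using (List; []; _∷_; tabulate)
open import Data.List.Membership.Propositional using (_∈_)
open import Data.List.Properties using () renaming (≡-dec to ≡-dec-List)
open import Data.List.Relation.Unary.Any using (here; there)
open import Data.Maybe using (Maybe; just; nothing; _>>=_)
open import Data.Maybe.Properties using () renaming (≡-dec to ≡-dec-Maybe)
open import Data.Nat
  using (ℕ; zero; suc; _+_; _*_; _∸_; _/_; _≤_; _<_; z≤n; s≤s; s≤s⁻¹; _≟_; _<?_; _≤ᵇ_; _≡ᵇ_; NonZero)
open import Data.Nat.Divisibility using (divides)
open import Data.Nat.DivMod
open import Data.Nat.Properties
open import Data.Nat.Tactic.RingSolver using (solve-∀)
open import Data.Product using (∃-syntax; ∃!; _×_; _,_; proj₁; proj₂)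
open import Data.Sum using (_⊎_; inj₁; inj₂)
open import Data.Unit using (tt)
open import Function using (case_of_; _∘′_)
open import Function.Bundles using (_⇔_; mk⇔; Equivalence)
open import Function.Definitions using (Injective)
open import Relation.Binary.Definitions using (tri<; tri≈; tri>)
open import Relation.Binary.PropositionalEquality
open import Relation.Nullary using (¬_; Dec; yes; no; does; contradiction; _→-dec_)
open import Relation.Nullary.Decidable using (map′; toWitness; T?)
open import Relation.Unary using (Decidable)

_⇒ᵇ_ _⇔ᵇ_ : Bool → Bool → Bool
true  ⇒ᵇ b = b
false ⇒ᵇ _ = true
true  ⇔ᵇ b = b
false ⇔ᵇ b = not b

⇒ᵇ-intro : ∀ {a b} → (T a → T b) → T (a ⇒ᵇ b)
⇒ᵇ-intro {false} _ = tt
⇒ᵇ-intro {true}  f = f tt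

⇔ᵇ-intro : ∀ {a b} → (T a → T b) → (T b → T a) → T (a ⇔ᵇ b)
⇔ᵇ-intro {false} {false} _ _ = tt
⇔ᵇ-intro {false} {true}  _ g = g tt
⇔ᵇ-intro {true}  {false} f _ = f tt
⇔ᵇ-intro {true}  {true}  _ _ = tt

⇔ᵇ-refl : ∀ a → T (a ⇔ᵇ a)
⇔ᵇ-refl a = ⇔ᵇ-intro {a} (λ t → t) (λ t → t)

infixr 4 _&_
_&_ : ∀ {a b} → T a → T b → T (a ∧ b)
_&_ {true} _ tb = tb

T-not-∧ : ∀ {a b} → T (not (a ∧ b)) ⇔ (T a → T b → ⊥)
T-not-∧ {a} {b} = mk⇔ (to a b) (from a b)
  where
  to : ∀ a b → T (not (a ∧ b)) → T a → T b → ⊥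
  to true true ()
  from : ∀ a b → (T a → T b → ⊥) → T (not (a ∧ b))
  from false _     _ = tt
  from true  false _ = tt
  from true  true  f = f tt tt

T-not : ∀ {b} → T (not b) ⇔ (T b → ⊥)
T-not {false} = mk⇔ (λ _ ()) (λ _ → tt)
T-not {true}  = mk⇔ (λ ()) (λ f → f tt)

does-≡ : ∀ {P : Set} (P? : Dec P) {b} → P ⇔ T b → does P? ≡ b
does-≡ (yes _) {true}  _ = refl
does-≡ (no _)  {false} _ = refl
does-≡ (yes p) {false} P⇔ = ⊥-elim (Equivalence.to P⇔ p)
does-≡ (no ¬p) {true}  P⇔ = ⊥-elim (¬p (Equivalence.from P⇔ tt))

parity : ∀ n → n % 2 ≡ 0 ⊎ n % 2 ≡ 1
parity n with n % 2 | m%n<n n 2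
... | 0 | _ = inj₁ refl
... | 1 | _ = inj₂ refl
... | suc (suc _) | s≤s (s≤s ())

%2-+2* : ∀ n d → (n + 2 * d) % 2 ≡ n % 2
%2-+2* n d = trans (cong (λ m → (n + m) % 2) (*-comm 2 d)) ([m+kn]%n≡m%n n d 2)

halve : ∀ {n} → n ≡ n % 2 + 2 * (n / 2)
halve {n} = trans (m≡m%n+[m/n]*n n 2) (cong (n % 2 +_) (*-comm (n / 2) 2))

residue≤2 : ∀ y → y % 3 ≤ 2
residue≤2 y = s≤s⁻¹ (m%n<n y 3)

residue-small : ∀ {y d} → 2 ≤ d → y % 3 ≤ d
residue-small {y} 2≤d = ≤-trans (residue≤2 y) 2≤d

≤-shift : ∀ w u c → u + c ≤ w + u + c
≤-shift w u c = subst (u + c ≤_) (sym (+-assoc w u c)) (m≤n+m (u + c) w)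

%6%3 : ∀ u → u % 6 % 3 ≡ u % 3
%6%3 u = m∣n⇒o%n%m≡o%m 3 6 u (divides 2 refl)

%6%2 : ∀ w → w % 6 % 2 ≡ w % 2
%6%2 w = m∣n⇒o%n%m≡o%m 2 6 w (divides 3 refl)

%6-offset : ∀ r m → r < 6 → (r + 6 * m) % 6 ≡ r
%6-offset r m r<6 = trans (cong (λ n → (r + n) % 6) (*-comm 6 m)) (trans ([m+kn]%n≡m%n r m 6) (m<n⇒m%n≡m r<6))

mod6-sum : ∀ x y c → (x % 6 + y % 6 + c) % 6 ≡ (x + y + c) % 6
mod6-sum x y c = sym (trans (cong (_% 6) split) ([m+kn]%n≡m%n (x % 6 + y % 6 + c) (x / 6 + y / 6) 6))
  where
  identity : ∀ r q s p c → r + q * 6 + (s + p * 6) + c ≡ r + s + c + (q + p) * 6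
  identity = solve-∀
  split : x + y + c ≡ x % 6 + y % 6 + c + (x / 6 + y / 6) * 6
  split = trans (cong₂ (λ x′ y′ → x′ + y′ + c) (m≡m%n+[m/n]*n x 6) (m≡m%n+[m/n]*n y 6))
                (identity (x % 6) (x / 6) (y % 6) (y / 6) c)

threshold : ∀ {m n} → T (m ≤ᵇ suc n) → T (not (m ≤ᵇ n)) → m ≡ suc n
threshold {m} {n} le ¬le = ≤-antisym (≤ᵇ⇒≤ _ _ le) (≰⇒> λ m≤n → Equivalence.to T-not ¬le (≤⇒≤ᵇ m≤n))

just≢nothing : ∀ {A : Set} {s : A} → just s ≢ nothing
just≢nothing ()

injective⇒onto : ∀ {n} {f : Fin n → Fin n} → Injective _≡_ _≡_ f → ∀ y → ∃[ x ] f x ≡ y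
injective⇒onto {suc n} {f} f-inj y with any? (λ x → f x Data.Fin.≟ y)
... | yes found = found
... | no missed = contradiction (injective⇒≤ squeezed-inj) (<⇒≱ (n<1+n n))
  where
  y≢f : ∀ x → y ≢ f x
  y≢f x y≡fx = missed (x , sym y≡fx)
  squeezed : Fin (suc n) → Fin n
  squeezed x = punchOut (y≢f x)
  squeezed-inj : Injective _≡_ _≡_ squeezed
  squeezed-inj {x} {x′} eq = f-inj (punchOut-injective (y≢f x) (y≢f x′) eq)

Distinct₃ : ℕ → ℕ → ℕ → Set
Distinct₃ x y z = x ≢ y × x ≢ z × y ≢ z

distinct₃⇒injective : ∀ {f : Fin 3 → ℕ} → Distinct₃ (f fzero) (f (fsuc fzero)) (f (fsuc (fsuc fzero))) →
                      ∀ {i j} → f i ≡ f j → i ≡ j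
distinct₃⇒injective _ {fzero} {fzero} _ = refl
distinct₃⇒injective _ {fsuc fzero} {fsuc fzero} _ = refl
distinct₃⇒injective _ {fsuc (fsuc fzero)} {fsuc (fsuc fzero)} _ = refl
distinct₃⇒injective (ne₀₁ , _ , _) {fzero} {fsuc fzero} eq = contradiction eq ne₀₁
distinct₃⇒injective (_ , ne₀₂ , _) {fzero} {fsuc (fsuc fzero)} eq = contradiction eq ne₀₂
distinct₃⇒injective (ne₀₁ , _ , _) {fsuc fzero} {fzero} eq = contradiction (sym eq) ne₀₁
distinct₃⇒injective (_ , _ , ne₁₂) {fsuc fzero} {fsuc (fsuc fzero)} eq = contradiction eq ne₁₂
distinct₃⇒injective (_ , ne₀₂ , _) {fsuc (fsuc fzero)} {fzero} eq = contradiction (sym eq) ne₀₂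
distinct₃⇒injective (_ , _ , ne₁₂) {fsuc (fsuc fzero)} {fsuc fzero} eq = contradiction (sym eq) ne₁₂

residues-exactly-once : ∀ n .{{_ : NonZero n}} (f : Fin n → ℕ) →
                        (∀ {i j} → f i % n ≡ f j % n → i ≡ j) →
                        ∀ r → ∃! _≡_ λ j → f j % n ≡ toℕ r
residues-exactly-once n f distinct r = j , hits , λ hits′ → distinct (trans hits (sym hits′))
  where
  residue : Fin n → Fin n
  residue j = fromℕ< (m%n<n (f j) n)
  toℕ-residue : ∀ j → toℕ (residue j) ≡ f j % n
  toℕ-residue j = toℕ-fromℕ< (m%n<n (f j) n)
  residue-inj : Injective _≡_ _≡_ residue
  residue-inj {i} {j} eq = distinct (trans (sym (toℕ-residue i)) (trans (cong toℕ eq) (toℕ-residue j)))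
  j = proj₁ (injective⇒onto residue-inj r)
  hits : f j % n ≡ toℕ r
  hits = trans (sym (toℕ-residue j)) (cong toℕ (proj₂ (injective⇒onto residue-inj r)))

-- Enumerating a set and scanning it block by block

-- The scan state is the list of residues mod 3, newest first, of the elements of the current
-- incomplete block of three; nothing records that a block has repeated a residue.
push : List ℕ → ℕ → Maybe (List ℕ)
push [] r = just (r ∷ [])
push (p ∷ []) r with r ≟ p
... | yes _ = nothing
... | no  _ = just (r ∷ p ∷ [])
push (p ∷ q ∷ []) r with r ≟ p | r ≟ q
... | no _ | no _ = just []
... | _    | _    = nothing
push (_ ∷ _ ∷ _ ∷ _) _ = nothing

push-single : ∀ p r {s} → push (p ∷ []) r ≡ just s → r ≢ p × s ≡ r ∷ p ∷ []
push-single p r eq with r ≟ p | eq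
... | no r≢p | refl = r≢p , refl

push-pair : ∀ p q r {s} → push (p ∷ q ∷ []) r ≡ just s → r ≢ p × r ≢ q × s ≡ []
push-pair p q r eq with r ≟ p | r ≟ q | eq
... | no r≢p | no r≢q | refl = r≢p , r≢q , refl

scanStep : Maybe (List ℕ) → Bool → ℕ → Maybe (List ℕ)
scanStep s false _ = s
scanStep s true  r = s >>= λ st → push st r

module Enumeration {P : ℕ → Set} (P? : Decidable P) (gap : ℕ)
                   (P-step : ∀ x → P x → P (x + suc gap)) (P-zero : P 0) where

  record IsNext (x y : ℕ) : Set where
    field
      member : P y
      above  : x < y
      skips  : ∀ z → x < z → z < y → ¬ P z

  search : ℕ → ℕ → ℕ
  search x zero = x
  search x (suc n) with P? (suc x)
  ... | yes _ = suc x
  ... | no  _ = search (suc x) n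

  search-next : ∀ n x → P (x + suc n) → IsNext x (search x (suc n))
  search-next n x p with P? (suc x)
  ... | yes p′ = record { member = p′ ; above = ≤-refl ; skips = λ z x<z z≤x → contradiction x<z (≤⇒≯ (s≤s⁻¹ z≤x)) }
  search-next zero x p | no ¬p′ = contradiction (subst P (+-comm x 1) p) ¬p′
  search-next (suc n) x p | no ¬p′ = record
    { member = IsNext.member rest
    ; above  = <-trans (n<1+n x) (IsNext.above rest)
    ; skips  = skips′ }
    where
    rest = search-next n (suc x) (subst P (+-suc x (suc n)) p)
    skips′ : ∀ z → x < z → z < search (suc x) (suc n) → ¬ P z
    skips′ z x<z z<y with z ≟ suc x
    ... | yes refl = ¬p′
    ... | no  z≢  = IsNext.skips rest z (≤∧≢⇒< x<z (z≢ ∘′ sym)) z<y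

  enum : ℕ → ℕ
  enum zero    = 0
  enum (suc i) = search (enum i) (suc gap)

  enum-member : ∀ i → P (enum i)
  enum-next   : ∀ i → IsNext (enum i) (enum (suc i))
  enum-next i = search-next gap (enum i) (P-step (enum i) (enum-member i))
  enum-member zero    = P-zero
  enum-member (suc i) = IsNext.member (enum-next i)

  enum-< : ∀ i → enum i < enum (suc i)
  enum-< i = IsNext.above (enum-next i)

  enum-bracket : ∀ x → ∃[ i ] (enum i ≤ x × x < enum (suc i))
  enum-bracket zero = 0 , z≤n , enum-< 0
  enum-bracket (suc x) with enum-bracket x
  ... | i , lo , hi with suc x <? enum (suc i)
  ...   | yes sx< = i , m≤n⇒m≤1+n lo , sx<
  ...   | no  sx≮ = suc i , ≮⇒≥ sx≮ , subst (_< enum (suc (suc i))) (≤-antisym (≮⇒≥ sx≮) hi) (enum-< (suc i))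

  enum-onto : ∀ {x} → P x → ∃[ i ] enum i ≡ x
  enum-onto {x} p with enum-bracket x
  ... | i , lo , hi with enum i ≟ x
  ...   | yes eq = i , eq
  ...   | no  ne = contradiction p (IsNext.skips (enum-next i) x (≤∧≢⇒< lo ne) hi)

  enum-suc-unique : ∀ i {y} → IsNext (enum i) y → enum (suc i) ≡ y
  enum-suc-unique i {y} y-next with <-cmp (enum (suc i)) y
  ... | tri≈ _ eq _ = eq
  ... | tri< lt _ _ = contradiction (enum-member (suc i)) (IsNext.skips y-next _ (enum-< i) lt)
  ... | tri> _ _ gt = contradiction (IsNext.member y-next) (IsNext.skips (enum-next i) y (IsNext.above y-next) gt)

  enumerates : Enumerates P enum
  enumerates = record
    { strictly-increasing = enum-<
    ; image = λ x → mk⇔ enum-onto (λ { (i , refl) → enum-member i }) }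

  scan : ℕ → Maybe (List ℕ)
  scan zero    = just []
  scan (suc x) = scanStep (scan x) (does (P? (suc x))) (suc x % 3)

  scan-suc : ∀ {x s m r} → scan x ≡ s → does (P? (suc x)) ≡ m → suc x % 3 ≡ r → scan (suc x) ≡ scanStep s m r
  scan-suc refl refl refl = refl

  scan-skip : ∀ x → ¬ P (suc x) → scan (suc x) ≡ scan x
  scan-skip x ¬p with P? (suc x)
  ... | yes p = contradiction p ¬p
  ... | no  _ = refl

  scan-gap : ∀ i d → enum i + d < enum (suc i) → scan (enum i + d) ≡ scan (enum i)
  scan-gap i zero    _  = cong scan (+-identityʳ (enum i))
  scan-gap i (suc d) lt = begin
    scan (enum i + suc d)  ≡⟨ cong scan (+-suc (enum i) d) ⟩
    scan (suc (enum i + d)) ≡⟨ scan-skip _ (IsNext.skips (enum-next i) _ (s≤s (m≤m+n (enum i) d)) lt′) ⟩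
    scan (enum i + d)       ≡⟨ scan-gap i d (<-trans (n<1+n _) lt′) ⟩
    scan (enum i)           ∎
    where
    open ≡-Reasoning
    lt′ : suc (enum i + d) < enum (suc i)
    lt′ = subst (_< enum (suc i)) (+-suc (enum i) d) lt

  scan-enum-suc : ∀ i {s} → scan (enum i) ≡ just s → scan (enum (suc i)) ≡ push s (enum (suc i) % 3)
  scan-enum-suc i {s} eq with m≤n⇒∃[o]m+o≡n (enum-< i)
  ... | d , sum = subst (λ y → scan y ≡ push s (y % 3)) sum (arrive _ sum)
    where
    arrive : ∀ y → y ≡ enum (suc i) → scanStep (scan (enum i + d)) (does (P? y)) (y % 3) ≡ push s (y % 3)
    arrive y refl with P? y
    ... | yes _ = cong (_>>= λ st → push st (y % 3)) (trans (scan-gap i d (subst (enum i + d <_) sum (n<1+n _))) eq)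
    ... | no ¬p = contradiction (enum-member (suc i)) ¬p

  module _ (never-stuck : ∀ x → scan x ≢ nothing) where

    scan-enum-suc-just : ∀ i {s} → scan (enum i) ≡ just s →
                     ∃[ s′ ] (push s (enum (suc i) % 3) ≡ just s′ × scan (enum (suc i)) ≡ just s′)
    scan-enum-suc-just i {s} eq with push s (enum (suc i) % 3) in pushed
    ... | just s′ = s′ , refl , trans (scan-enum-suc i eq) pushed
    ... | nothing = contradiction (trans (scan-enum-suc i eq) pushed) (never-stuck (enum (suc i)))

    scan-block : ∀ j → scan (enum (j * 3)) ≡ just [] →
            Distinct₃ (enum (1 + j * 3) % 3) (enum (2 + j * 3) % 3) (enum (3 + j * 3) % 3) ×
            scan (enum (3 + j * 3)) ≡ just []
    scan-block j start
      with s₂ , pushed₂ , at₂ ← scan-enum-suc-just (1 + j * 3) (scan-enum-suc (j * 3) start)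
      with r₂≢r₁ , refl ← push-single _ _ pushed₂
      with s₃ , pushed₃ , at₃ ← scan-enum-suc-just (2 + j * 3) at₂
      with r₃≢r₂ , r₃≢r₁ , refl ← push-pair _ _ _ pushed₃
      = (r₂≢r₁ ∘′ sym , r₃≢r₁ ∘′ sym , r₃≢r₂ ∘′ sym) , at₃

    blocks-start-empty : ∀ j → scan (enum (j * 3)) ≡ just []
    blocks-start-empty zero    = refl
    blocks-start-empty (suc j) = proj₂ (scan-block j (blocks-start-empty j))

    blocks-permute-residues : ∀ j (r : Fin 3) → ∃! _≡_ λ (t : Fin 3) → enum (j * 3 + suc (toℕ t)) % 3 ≡ toℕ r
    blocks-permute-residues j = residues-exactly-once 3 f (distinct₃⇒injective distinct)
      where
      f : Fin 3 → ℕ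
      f t = enum (j * 3 + suc (toℕ t))
      shift : ∀ t → j * 3 + suc t ≡ suc t + j * 3
      shift t = +-comm (j * 3) (suc t)
      distinct : Distinct₃ (f fzero % 3) (f (fsuc fzero) % 3) (f (fsuc (fsuc fzero)) % 3)
      distinct rewrite shift 0 | shift 1 | shift 2 = proj₁ (scan-block j (blocks-start-empty j))

-- Abstract positions

-- Abstraction of the position u H + w with w < H: u mod 6, w mod 6 and the truth values of
-- H ≤ w + u + 1, 2H ≤ w + u + 2, H ≤ u + 1, 2H ≤ u + 2, w = 0, w = H − 2 and w = H − 1
-- (written i j f1 f2 ra rb z h2 h1 in patterns); see viewAt.
record View : Set where
  constructor view
  field
    row col : ℕ
    oddOn evenOn rowOddOn rowFull atStart atH₋₂ atH₋₁ : Bool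

next6 : ℕ → ℕ
next6 i = suc i % 6

member : View → Bool
member (view i j f1 f2 _ rb z h2 _) =
  if z then (i % 3 ≡ᵇ 0) ∨ rb
  else if j % 2 ≡ᵇ 1 then (f1 ∧ not (h2 ∧ (i % 3 ≡ᵇ 0))) ∨ rb
  else f2

residue : View → ℕ
residue v = (2 * View.row v + View.col v) % 3

run : ℕ → ℕ → ℕ → List ℕ
run zero    _ _ = []
run (suc n) ρ β = ρ ∷ run n ((ρ + β) % 3) β

evenState : ℕ → ℕ → Bool → Bool → List ℕ
evenState 0 3 true _    = 2 ∷ []
evenState 0 4 _    true = 1 ∷ 2 ∷ []
evenState 3 3 true _    = []
evenState 3 4 _    true = 1 ∷ []
evenState i j _    _    = run ((2 + 2 * (i / 2) + j) % 3) ((2 * i + j) % 3) 2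

oddState : ℕ → ℕ → Bool → Bool → Bool → List ℕ
oddState 0 0 true _    _    = 0 ∷ 2 ∷ []
oddState 0 3 _    true _    = []
oddState 0 4 _    _    true = []
oddState 3 3 _    true _    = 1 ∷ []
oddState 3 4 _    _    true = 1 ∷ []
oddState i j _    _    _    =
  run ((2 + i / 2 + suc j / 2) % 3) ((2 * i + (if j % 2 ≡ᵇ 1 then j else (j + 5) % 6)) % 3) 1

-- The scan state at an abstract position: generically a run given by an affine formula; the special
-- clauses account for the element u H at w = 0 and for the element (u + 1) H − 2, which rows with
-- 3 ∣ u lack until they are full.
state : View → List ℕ
state (view i j _  _     _ true  _ _  _ ) = run ((2 * i + j) % 3) ((2 * i + j) % 3) 2
state (view i j _  true  _ false _ h2 h1) = evenState i j h2 h1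
state (view i j true false _ false z h2 h1) = oddState i j z h2 h1
state (view i j false false _ false _ _ _) = if i % 2 ≡ᵇ 0 then i % 3 ∷ [] else []

coherent : View → Bool
coherent (view i j f1 f2 ra rb z h2 h1) =
  (z ⇒ᵇ (j ≡ᵇ 0)) ∧ (h1 ⇒ᵇ (j ≡ᵇ 4)) ∧ not (h2 ∧ h1) ∧ (f2 ⇒ᵇ f1) ∧ (rb ⇒ᵇ (ra ∧ f2)) ∧
  ((h2 ∨ h1) ⇒ᵇ f1) ∧ (z ⇒ᵇ ((f1 ⇔ᵇ ra) ∧ (f2 ⇔ᵇ rb))) ∧ (h1 ⇒ᵇ (f2 ⇔ᵇ ra))

nextCell : View → Bool → Bool → Bool → View
nextCell (view i j _ _ ra rb _ h2 _) f1′ f2′ h2′ = view i (next6 j) f1′ f2′ ra rb false h2′ h2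

nextRow : View → Bool → Bool → View
nextRow v ra′ rb′ = view (next6 (View.row v)) 0 ra′ rb′ ra′ rb′ true false false

cellMove : View → View → Bool
cellMove (view i _ f1 f2 _ _ _ _ _) (view _ j′ f1′ f2′ _ _ _ h2′ _) =
  (f1 ⇒ᵇ f1′) ∧ ((f1′ ∧ not f1) ⇒ᵇ ((j′ + i + 1) % 6 ≡ᵇ 5)) ∧
  (f2 ⇒ᵇ f2′) ∧ ((f2′ ∧ not f2) ⇒ᵇ ((j′ + i + 2) % 6 ≡ᵇ 4)) ∧ (h2′ ⇒ᵇ (j′ ≡ᵇ 3))

rowMove : View → View → Bool
rowMove (view i _ _ _ ra rb _ _ _) (view _ _ _ _ ra′ rb′ _ _ _) =
  (ra ⇒ᵇ ra′) ∧ ((ra′ ∧ not ra) ⇒ᵇ (i ≡ᵇ 3)) ∧ (rb ⇒ᵇ rb′) ∧ ((rb′ ∧ not rb) ⇒ᵇ (i ≡ᵇ 1))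

Steps : View → View → Set
Steps v v′ = scanStep (just (state v)) (member v′) (residue v′) ≡ just (state v′)

steps? : ∀ v v′ → Dec (Steps v v′)
steps? v v′ = ≡-dec-Maybe (≡-dec-List _≟_) _ _

allBool? : ∀ {P : Bool → Set} → (∀ b → Dec (P b)) → Dec (∀ b → P b)
allBool? P? with P? true | P? false
... | yes pt | yes pf = yes λ { true → pt ; false → pf }
... | no ¬pt | _      = no λ all → ¬pt (all true)
... | yes _  | no ¬pf = no λ all → ¬pf (all false)

all-cell-steps : ∀ {i} → i < 6 → ∀ {j} → j < 6 → ∀ f1 f2 ra rb z h2 h1 f1′ f2′ h2′ →
             let v = view i j f1 f2 ra rb z h2 h1 ; v′ = nextCell v f1′ f2′ h2′ in
             T (not h1) → T (coherent v) → T (coherent v′) → T (cellMove v v′) → Steps v v′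
all-cell-steps = toWitness {a? = allUpTo? (λ i → allUpTo? (λ j →
  allBool? λ f1 → allBool? λ f2 → allBool? λ ra → allBool? λ rb → allBool? λ z → allBool? λ h2 → allBool? λ h1 →
  allBool? λ f1′ → allBool? λ f2′ → allBool? λ h2′ →
  let v = view i j f1 f2 ra rb z h2 h1 ; v′ = nextCell v f1′ f2′ h2′ in
  T? (not h1) →-dec T? (coherent v) →-dec T? (coherent v′) →-dec T? (cellMove v v′) →-dec steps? v v′) 6) 6} _

all-row-steps : ∀ {i} → i < 6 → ∀ {j} → j < 6 → ∀ f1 f2 ra rb z h2 h1 ra′ rb′ →
            let v = view i j f1 f2 ra rb z h2 h1 ; v′ = nextRow v ra′ rb′ in
            T h1 → T (coherent v) → T (coherent v′) → T (rowMove v v′) → Steps v v′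
all-row-steps = toWitness {a? = allUpTo? (λ i → allUpTo? (λ j →
  allBool? λ f1 → allBool? λ f2 → allBool? λ ra → allBool? λ rb → allBool? λ z → allBool? λ h2 → allBool? λ h1 →
  allBool? λ ra′ → allBool? λ rb′ →
  let v = view i j f1 f2 ra rb z h2 h1 ; v′ = nextRow v ra′ rb′ in
  T? h1 →-dec T? (coherent v) →-dec T? (coherent v′) →-dec T? (rowMove v v′) →-dec steps? v v′) 6) 6} _

coherent-intro : ∀ v → let open View v in
  T (atStart ⇒ᵇ (col ≡ᵇ 0)) → T (atH₋₁ ⇒ᵇ (col ≡ᵇ 4)) → T (not (atH₋₂ ∧ atH₋₁)) → T (evenOn ⇒ᵇ oddOn) →
  T (rowFull ⇒ᵇ (rowOddOn ∧ evenOn)) → T ((atH₋₂ ∨ atH₋₁) ⇒ᵇ oddOn) →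
  T (atStart ⇒ᵇ ((oddOn ⇔ᵇ rowOddOn) ∧ (evenOn ⇔ᵇ rowFull))) → T (atH₋₁ ⇒ᵇ (evenOn ⇔ᵇ rowOddOn)) →
  T (coherent v)
coherent-intro _ c₁ c₂ c₃ c₄ c₅ c₆ c₇ c₈ = c₁ & c₂ & c₃ & c₄ & c₅ & c₆ & c₇ & c₈

cellMove-intro : ∀ v v′ → let open View in
  T (oddOn v ⇒ᵇ oddOn v′) → T ((oddOn v′ ∧ not (oddOn v)) ⇒ᵇ ((col v′ + row v + 1) % 6 ≡ᵇ 5)) →
  T (evenOn v ⇒ᵇ evenOn v′) → T ((evenOn v′ ∧ not (evenOn v)) ⇒ᵇ ((col v′ + row v + 2) % 6 ≡ᵇ 4)) →
  T (atH₋₂ v′ ⇒ᵇ (col v′ ≡ᵇ 3)) → T (cellMove v v′)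
cellMove-intro _ _ c₁ c₂ c₃ c₄ c₅ = c₁ & c₂ & c₃ & c₄ & c₅

rowMove-intro : ∀ v v′ → let open View in
  T (rowOddOn v ⇒ᵇ rowOddOn v′) → T ((rowOddOn v′ ∧ not (rowOddOn v)) ⇒ᵇ (row v ≡ᵇ 3)) →
  T (rowFull v ⇒ᵇ rowFull v′) → T ((rowFull v′ ∧ not (rowFull v)) ⇒ᵇ (row v ≡ᵇ 1)) → T (rowMove v v′)
rowMove-intro _ _ c₁ c₂ c₃ c₄ = c₁ & c₂ & c₃ & c₄

cell-step : ∀ v f1′ f2′ h2′ → let v′ = nextCell v f1′ f2′ h2′ in View.row v < 6 → View.col v < 6 →
            T (not (View.atH₋₁ v)) → T (coherent v) → T (coherent v′) → T (cellMove v v′) → Steps v v′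
cell-step (view i j f1 f2 ra rb z h2 h1) f1′ f2′ h2′ i<6 j<6 =
  all-cell-steps i<6 j<6 f1 f2 ra rb z h2 h1 f1′ f2′ h2′

row-step : ∀ v ra′ rb′ → let v′ = nextRow v ra′ rb′ in View.row v < 6 → View.col v < 6 →
           T (View.atH₋₁ v) → T (coherent v) → T (coherent v′) → T (rowMove v v′) → Steps v v′
row-step (view i j f1 f2 ra rb z h2 h1) ra′ rb′ i<6 j<6 =
  all-row-steps i<6 j<6 f1 f2 ra rb z h2 h1 ra′ rb′

-- The semigroup ⟨ 12k + 8, 18k + 13, 18k + 15 ⟩

module Semigroup (k : ℕ) where

  a b c : ℕ
  a = 12 * k + 8
  b = a + a / 2 + 1
  c = a + a / 2 + 3

  gens : List ℕ
  gens = a ∷ b ∷ c ∷ []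

  G : ℕ → Set
  G = ⟨ gens ⟩

  PaperForm : ℕ → Set
  PaperForm x = ∃[ q ] ∃[ r ] ∃[ s ] (r ≤ q × x ≡ (s + q) * a + q * (a / 2) + q + 2 * r)

  ⟨⟩⇒paper : ∀ {x} → G x → PaperForm x
  ⟨⟩⇒paper gen-zero = 0 , 0 , 0 , z≤n , refl
  ⟨⟩⇒paper (gen-add (here refl) gx) with ⟨⟩⇒paper gx
  ... | q , r , s , r≤q , refl = q , r , suc s , r≤q , identity a (a / 2) q r s
    where identity : ∀ A h q r s → A + ((s + q) * A + q * h + q + 2 * r) ≡ (suc s + q) * A + q * h + q + 2 * r
          identity = solve-∀
  ⟨⟩⇒paper (gen-add (there (here refl)) gx) with ⟨⟩⇒paper gx
  ... | q , r , s , r≤q , refl = suc q , r , s , m≤n⇒m≤1+n r≤q , identity a (a / 2) q r s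
    where identity : ∀ A h q r s → A + h + 1 + ((s + q) * A + q * h + q + 2 * r) ≡
                                   (s + suc q) * A + suc q * h + suc q + 2 * r
          identity = solve-∀
  ⟨⟩⇒paper (gen-add (there (there (here refl))) gx) with ⟨⟩⇒paper gx
  ... | q , r , s , r≤q , refl = suc q , suc r , s , s≤s r≤q , identity a (a / 2) q r s
    where identity : ∀ A h q r s → A + h + 3 + ((s + q) * A + q * h + q + 2 * r) ≡
                                   (s + suc q) * A + suc q * h + suc q + 2 * suc r
          identity = solve-∀

  add-copies : ∀ n {g y} → g ∈ gens → G y → G (n * g + y)
  add-copies zero    _   gy = gy
  add-copies (suc n) {g} {y} g∈ gy = subst G (sym (+-assoc g (n * g) y)) (gen-add g∈ (add-copies n g∈ gy))

  paper⇒⟨⟩ : ∀ {x} → PaperForm x → G x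
  paper⇒⟨⟩ (q , r , s , r≤q , eq) with m≤n⇒∃[o]m+o≡n r≤q
  ... | e , refl = subst G (sym (trans eq (identity a (a / 2) r e s)))
        (add-copies s (here refl) (add-copies e (there (here refl))
          (add-copies r (there (there (here refl))) gen-zero)))
    where identity : ∀ A h r e s → (s + (r + e)) * A + (r + e) * h + (r + e) + 2 * r ≡
                                   s * A + (e * (A + h + 1) + (r * (A + h + 3) + 0))
          identity = solve-∀

  H₋₂ H : ℕ
  H₋₂ = 3 + 6 * k
  H   = suc (suc H₋₂)

  half-a : a / 2 ≡ suc H₋₂
  half-a = trans (cong (_/ 2) (identity k)) (m*n/n≡m (suc H₋₂) 2)
    where identity : ∀ k → 12 * k + 8 ≡ suc (3 + 6 * k) * 2
          identity = solve-∀

  a+2≡2H : a + 2 ≡ 2 * H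
  a+2≡2H = identity k
    where identity : ∀ k → 12 * k + 8 + 2 ≡ 2 * suc (suc (3 + 6 * k))
          identity = solve-∀

  b+2≡3H : b + 2 ≡ 3 * H
  b+2≡3H = trans (cong (λ h → a + h + 1 + 2) half-a) (identity k)
    where identity : ∀ k → 12 * k + 8 + suc (3 + 6 * k) + 1 + 2 ≡ 3 * suc (suc (3 + 6 * k))
          identity = solve-∀

  c≡3H : c ≡ 3 * H
  c≡3H = trans (cong (λ h → a + h + 3) half-a) (identity k)
    where identity : ∀ k → 12 * k + 8 + suc (3 + 6 * k) + 3 ≡ 3 * suc (suc (3 + 6 * k))
          identity = solve-∀

  -- x = y H + d a, multiplied out with a + 2 = 2H so that no subtraction occurs.
  Lattice : ℕ → Set
  Lattice x = ∃[ y ] ∃[ d ] (y % 3 ≤ d × x + 2 * d ≡ (y + 2 * d) * H)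

  lattice-+ : ∀ {x x′} → Lattice x → Lattice x′ → Lattice (x + x′)
  lattice-+ {x} {x′} (y , d , y≤d , eq) (y′ , d′ , y′≤d′ , eq′) = y + y′ , d + d′ , residue-bound , sum-eq
    where
    sum-eq : x + x′ + 2 * (d + d′) ≡ (y + y′ + 2 * (d + d′)) * H
    sum-eq = begin
      x + x′ + 2 * (d + d′)               ≡⟨ regroup x x′ d d′ ⟩
      (x + 2 * d) + (x′ + 2 * d′)         ≡⟨ cong₂ _+_ eq eq′ ⟩
      (y + 2 * d) * H + (y′ + 2 * d′) * H ≡⟨ collect y y′ d d′ H ⟩
      (y + y′ + 2 * (d + d′)) * H         ∎
      where
      open ≡-Reasoning
      regroup : ∀ x x′ d d′ → x + x′ + 2 * (d + d′) ≡ (x + 2 * d) + (x′ + 2 * d′)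
      regroup = solve-∀
      collect : ∀ y y′ d d′ H → (y + 2 * d) * H + (y′ + 2 * d′) * H ≡ (y + y′ + 2 * (d + d′)) * H
      collect = solve-∀
    residue-bound : (y + y′) % 3 ≤ d + d′
    residue-bound = begin
      (y + y′) % 3         ≡⟨ %-distribˡ-+ y y′ 3 ⟩
      (y % 3 + y′ % 3) % 3 ≤⟨ m%n≤m (y % 3 + y′ % 3) 3 ⟩
      y % 3 + y′ % 3       ≤⟨ +-mono-≤ y≤d y′≤d′ ⟩
      d + d′               ∎
      where open ≤-Reasoning

  ⟨⟩⇒lattice : ∀ {x} → G x → Lattice x
  ⟨⟩⇒lattice gen-zero = 0 , 0 , z≤n , refl
  ⟨⟩⇒lattice (gen-add {g} {x} g∈ gx) = lattice-+ {g} {x} (generator g∈) (⟨⟩⇒lattice gx)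
    where
    generator : ∀ {g} → g ∈ gens → Lattice g
    generator (here refl)                 = 0 , 1 , z≤n , a+2≡2H
    generator (there (here refl))         = 1 , 1 , s≤s z≤n , b+2≡3H
    generator (there (there (here refl))) = 3 , 0 , z≤n , trans (+-identityʳ c) c≡3H

  lattice⇒⟨⟩ : ∀ {x} → Lattice x → G x
  lattice⇒⟨⟩ {x} (y , d , y%3≤d , eq) with m≤n⇒∃[o]m+o≡n y%3≤d
  ... | e , refl = subst G (sym x≡) (add-copies (y / 3) (there (there (here refl)))
                     (add-copies (y % 3) (there (here refl)) (add-copies e (here refl) gen-zero)))
    where
    open ≡-Reasoning
    β = y % 3
    γ = y / 3
    combination = γ * c + (β * b + (e * a + 0))
    shifted : combination + 2 * (β + e) ≡ (y + 2 * (β + e)) * H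
    shifted = begin
      combination + 2 * (β + e)                     ≡⟨ regroup γ β e c b a ⟩
      γ * c + β * (b + 2) + e * (a + 2)             ≡⟨ cong₂ (λ C B → γ * C + β * B + e * (a + 2)) c≡3H b+2≡3H ⟩
      γ * (3 * H) + β * (3 * H) + e * (a + 2)       ≡⟨ cong (λ A → γ * (3 * H) + β * (3 * H) + e * A) a+2≡2H ⟩
      γ * (3 * H) + β * (3 * H) + e * (2 * H)       ≡⟨ collect γ β e H ⟩
      (β + γ * 3 + 2 * (β + e)) * H                 ≡⟨ cong (λ Y → (Y + 2 * (β + e)) * H) (sym (m≡m%n+[m/n]*n y 3)) ⟩
      (y + 2 * (β + e)) * H                         ∎
      where
      regroup : ∀ γ β e c b a → γ * c + (β * b + (e * a + 0)) + 2 * (β + e) ≡ γ * c + β * (b + 2) + e * (a + 2)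
      regroup = solve-∀
      collect : ∀ γ β e H → γ * (3 * H) + β * (3 * H) + e * (2 * H) ≡ (β + γ * 3 + 2 * (β + e)) * H
      collect = solve-∀
    x≡ : x ≡ combination
    x≡ = +-cancelʳ-≡ (2 * (β + e)) x combination (trans eq (sym shifted))

  -- u H + w is the lattice point (y, d) whose column top (y + 2d) H lies t rows above row u.
  LatticeAt : ℕ → ℕ → Set
  LatticeAt u w = ∃[ t ] ∃[ d ] ∃[ y ] (w + 2 * d ≡ t * H × y + 2 * d ≡ u + t × y % 3 ≤ d)

  lattice⇒at : ∀ {u w} → Lattice (u * H + w) → LatticeAt u w
  lattice⇒at {u} {w} (y , d , y%3≤d , eq) = y + 2 * d ∸ u , d , y , offset , sym (m+[n∸m]≡n u≤n) , y%3≤d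
    where
    n = y + 2 * d
    split : u * H + (w + 2 * d) ≡ n * H
    split = trans (sym (+-assoc (u * H) w (2 * d))) eq
    u≤n : u ≤ n
    u≤n = *-cancelʳ-≤ u n H (≤-trans (m≤m+n (u * H) (w + 2 * d)) (≤-reflexive split))
    offset : w + 2 * d ≡ (n ∸ u) * H
    offset = +-cancelˡ-≡ (u * H) _ _
      (trans split (trans (cong (_* H) (sym (m+[n∸m]≡n u≤n))) (*-distribʳ-+ H u (n ∸ u))))

  at⇒lattice : ∀ {u w} → LatticeAt u w → Lattice (u * H + w)
  at⇒lattice {u} {w} (t , d , y , offset , column , y%3≤d) = y , d , y%3≤d , (begin
    u * H + w + 2 * d   ≡⟨ +-assoc (u * H) w (2 * d) ⟩
    u * H + (w + 2 * d) ≡⟨ cong (u * H +_) offset ⟩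
    u * H + t * H       ≡⟨ *-distribʳ-+ H u t ⟨
    (u + t) * H         ≡⟨ cong (_* H) column ⟨
    (y + 2 * d) * H     ∎)
    where open ≡-Reasoning

  mkLatticeAt : ∀ {u w} t d → w + 2 * d ≡ t * H → 2 * d ≤ u + t →
                (∀ y → y + 2 * d ≡ u + t → y % 3 ≤ d) → LatticeAt u w
  mkLatticeAt {u} t d offset fits residue-ok with m≤n⇒∃[o]m+o≡n fits
  ... | y , sum = t , d , y , offset , column , residue-ok y column
    where column = trans (+-comm y (2 * d)) sum

  data InRow (u w : ℕ) : Set where
    start-multiple : w ≡ 0 → u % 3 ≡ 0 → InRow u w
    start-full     : w ≡ 0 → 2 * H ≤ u + 2 → InRow u w
    odd            : w % 2 ≡ 1 → H ≤ w + u + 1 → (w ≡ H₋₂ → u % 3 ≢ 0) → InRow u w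
    odd-full       : w ≡ H₋₂ → 2 * H ≤ u + 2 → u % 3 ≡ 0 → InRow u w
    even           : w % 2 ≡ 0 → 0 < w → 2 * H ≤ w + u + 2 → InRow u w

  H≡ : H ≡ 1 + 2 * (3 * k + 2)
  H≡ = identity k
    where identity : ∀ k → suc (suc (3 + 6 * k)) ≡ 1 + 2 * (3 * k + 2)
          identity = solve-∀

  H-odd : H % 2 ≡ 1
  H-odd = trans (cong (_% 2) H≡) (%2-+2* 1 (3 * k + 2))

  2H-even : (2 * H) % 2 ≡ 0
  2H-even = %2-+2* 0 H

  H₋₂-odd : H₋₂ % 2 ≡ 1
  H₋₂-odd = trans (cong (_% 2) (identity k)) (%2-+2* 1 (1 + 3 * k))
    where identity : ∀ k → 3 + 6 * k ≡ 1 + 2 * (1 + 3 * k)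
          identity = solve-∀

  odd-below-H : ∀ {w} → w % 2 ≡ 1 → w < H → ∃[ e ] w + 2 * suc e ≡ H
  odd-below-H {w} w-odd w<H = e , (begin
    w + 2 * suc e                   ≡⟨ cong (_+ 2 * suc e) w≡ ⟩
    1 + 2 * (w / 2) + 2 * suc e     ≡⟨ identity (w / 2) e ⟩
    1 + 2 * (suc (w / 2) + e)       ≡⟨ cong (λ m → 1 + 2 * m) sum ⟩
    1 + 2 * (3 * k + 2)             ≡⟨ H≡ ⟨
    H                               ∎)
    where
    open ≡-Reasoning
    w≡ : w ≡ 1 + 2 * (w / 2)
    w≡ = trans halve (cong (_+ 2 * (w / 2)) w-odd)
    half< : w / 2 < 3 * k + 2
    half< = *-cancelˡ-< 2 (w / 2) (3 * k + 2) (s≤s⁻¹ (subst₂ _<_ w≡ H≡ w<H))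
    e = proj₁ (m≤n⇒∃[o]m+o≡n half<)
    sum = proj₂ (m≤n⇒∃[o]m+o≡n half<)
    identity : ∀ h e → 1 + 2 * h + 2 * suc e ≡ 1 + 2 * (suc h + e)
    identity = solve-∀

  even-below-H : ∀ {w} → w % 2 ≡ 0 → w < H → ∃[ e ] w + 2 * e ≡ 2 * H
  even-below-H {w} w-even w<H = e , (begin
    w + 2 * e               ≡⟨ cong (_+ 2 * e) w≡ ⟩
    2 * (w / 2) + 2 * e     ≡⟨ *-distribˡ-+ 2 (w / 2) e ⟨
    2 * (w / 2 + e)         ≡⟨ cong (2 *_) sum ⟩
    2 * H                   ∎)
    where
    open ≡-Reasoning
    w≡ : w ≡ 2 * (w / 2)
    w≡ = trans halve (cong (_+ 2 * (w / 2)) w-even)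
    half≤ : w / 2 ≤ H
    half≤ = ≤-trans (m/n≤m w 2) (<⇒≤ w<H)
    e = proj₁ (m≤n⇒∃[o]m+o≡n half≤)
    sum = proj₂ (m≤n⇒∃[o]m+o≡n half≤)

  two≤d : ∀ {w t d} → w < H → w + 2 * d ≡ (2 + t) * H → 2 ≤ d
  two≤d {w} {t} {d} w<H offset = helper d H<2d
    where
    H<2d : H < 2 * d
    H<2d = +-cancelʳ-< w H (2 * d) (begin-strict
      H + w           <⟨ +-monoʳ-< H w<H ⟩
      H + H           ≤⟨ m≤m+n (H + H) (t * H) ⟩
      H + H + t * H   ≡⟨ identity H t ⟩
      (2 + t) * H     ≡⟨ offset ⟨
      w + 2 * d       ≡⟨ +-comm w (2 * d) ⟩
      2 * d + w       ∎)
      where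
      open ≤-Reasoning
      identity : ∀ H t → H + H + t * H ≡ (2 + t) * H
      identity = solve-∀
    helper : ∀ d → H < 2 * d → 2 ≤ d
    helper (suc (suc _)) _ = s≤s (s≤s z≤n)
    helper zero ()
    helper (suc zero) (s≤s (s≤s ()))

  full⇒H≤u+1 : ∀ {u} → 2 * H ≤ u + 2 → H ≤ u + 1
  full⇒H≤u+1 {u} full = +-cancelʳ-≤ 1 H (u + 1) (begin
    H + 1         ≤⟨ +-monoʳ-≤ H (s≤s z≤n) ⟩
    H + H         ≡⟨ cong (H +_) (+-identityʳ H) ⟨
    2 * H         ≤⟨ full ⟩
    u + 2         ≡⟨ +-assoc u 1 1 ⟨
    u + 1 + 1     ∎)
    where open ≤-Reasoning

  full-row⇒inRow : ∀ {u w} → 2 * H ≤ u + 2 → InRow u w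
  full-row⇒inRow {u} {w} full with w ≟ 0 | parity w
  ... | yes w≡0 | _      = start-full w≡0 full
  ... | no  w≢0 | inj₁ e = even e (n≢0⇒n>0 w≢0) (≤-trans full (≤-shift w u 2))
  ... | no  _   | inj₂ o with w ≟ H₋₂ | u % 3 ≟ 0
  ...   | yes w≡ | yes u≡ = odd-full w≡ full u≡
  ...   | yes _  | no  u≢ = odd o H≤ (λ _ → u≢)
    where H≤ = ≤-trans (full⇒H≤u+1 full) (≤-shift w u 1)
  ...   | no  w≢ | _      = odd o H≤ (λ w≡ → contradiction w≡ w≢)
    where H≤ = ≤-trans (full⇒H≤u+1 full) (≤-shift w u 1)

  column-bound : ∀ {u w t d y} → w + 2 * d ≡ t * H → y + 2 * d ≡ u + t → t * H ≤ w + (u + t)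
  column-bound {u} {w} {t} {d} {y} offset column = begin
    t * H           ≡⟨ offset ⟨
    w + 2 * d       ≤⟨ +-monoʳ-≤ w (m≤n+m (2 * d) y) ⟩
    w + (y + 2 * d) ≡⟨ cong (w +_) column ⟩
    w + (u + t)     ∎
    where open ≤-Reasoning

  deep⇒full : ∀ {u w g d y} → w < H → w + 2 * d ≡ (3 + g) * H → y + 2 * d ≡ u + (3 + g) → 2 * H ≤ u + 2
  deep⇒full {u} {w} {g} {d} {y} w<H offset column = +-cancelʳ-≤ g (2 * H) (u + 2) (begin
    2 * H + g       ≤⟨ +-monoʳ-≤ (2 * H) (m≤m*n g H) ⟩
    2 * H + g * H   ≤⟨ s≤s⁻¹ (+-cancelˡ-< H _ _ (begin-strict
        H + (2 * H + g * H)   ≡⟨ identity H g ⟩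
        (3 + g) * H           ≤⟨ column-bound {u} {w} {3 + g} {d} {y} offset column ⟩
        w + (u + (3 + g))     <⟨ +-monoˡ-< (u + (3 + g)) w<H ⟩
        H + (u + (3 + g))     ≡⟨ cong (H +_) (identity′ u g) ⟩
        H + suc (u + 2 + g)   ∎)) ⟩
    u + 2 + g       ∎)
    where
    open ≤-Reasoning
    identity : ∀ H g → H + (2 * H + g * H) ≡ (3 + g) * H
    identity = solve-∀
    identity′ : ∀ u g → u + (3 + g) ≡ suc (u + 2 + g)
    identity′ = solve-∀

  at⇒inRow : ∀ {u w} → w < H → LatticeAt u w → InRow u w
  at⇒inRow {u} {w} _ (zero , zero , y , offset , column , y%3≤0) =
    start-multiple (trans (sym (+-identityʳ w)) offset)
                   (n≤0⇒n≡0 (subst (λ v → v % 3 ≤ 0) (+-cancelʳ-≡ 0 y u column) y%3≤0))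
  at⇒inRow {u} {w} _ (zero , suc d , _ , offset , _) = contradiction offset (m+1+n≢0 w)
  at⇒inRow {u} {w} _ (1 , d , y , offset , column , y%3≤d) = odd w-odd bound exception
    where
    w+2d≡H : w + 2 * d ≡ H
    w+2d≡H = trans offset (+-identityʳ H)
    w-odd : w % 2 ≡ 1
    w-odd = trans (sym (%2-+2* w d)) (trans (cong (_% 2) w+2d≡H) H-odd)
    bound : H ≤ w + u + 1
    bound = subst₂ _≤_ (+-identityʳ H) (sym (+-assoc w u 1)) (column-bound {u} {w} {1} {d} {y} offset column)
    exception : w ≡ H₋₂ → u % 3 ≢ 0
    exception refl u%3≡0 = contradiction y%3≡2 (λ eq → <⇒≱ (s≤s (s≤s z≤n)) (subst (_≤ 1) eq y%3≤1))
      where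
      d≡1 : d ≡ 1
      d≡1 = *-cancelˡ-≡ d 1 2 (+-cancelˡ-≡ H₋₂ _ _ (trans w+2d≡H (+-comm 2 H₋₂)))
      y%3≤1 : y % 3 ≤ 1
      y%3≤1 = subst (y % 3 ≤_) d≡1 y%3≤d
      u≡1+y : u ≡ suc y
      u≡1+y = +-cancelʳ-≡ 1 u (suc y) (trans (sym column) (trans (cong (λ e → y + 2 * e) d≡1) (+-suc y 1)))
      y%3≡2 : y % 3 ≡ 2
      y%3≡2 = %-pred-≡0 {y} (subst (λ v → v % 3 ≡ 0) u≡1+y u%3≡0)
  at⇒inRow {u} {w} _ (2 , d , y , offset , column , _) with w ≟ 0
  ... | yes w≡0 = start-full w≡0 (subst (λ v → 2 * H ≤ v + (u + 2)) w≡0 bound)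
    where bound = column-bound {u} {w} {2} {d} {y} offset column
  ... | no  w≢0 = even w-even (n≢0⇒n>0 w≢0) (subst (2 * H ≤_) (sym (+-assoc w u 2)) bound)
    where
    bound = column-bound {u} {w} {2} {d} {y} offset column
    w-even : w % 2 ≡ 0
    w-even = trans (sym (%2-+2* w d)) (trans (cong (_% 2) offset) 2H-even)
  at⇒inRow {u} {w} w<H (suc (suc (suc g)) , d , y , offset , column , _) =
    full-row⇒inRow (deep⇒full {u} {w} {g} {d} {y} w<H offset column)

  full-row-strict : ∀ {u} → u % 3 ≡ 0 → 2 * H ≤ u + 2 → 2 * H ≤ u + 1
  full-row-strict {u} u%3≡0 full with m≤n⇒m<n∨m≡n full
  ... | inj₁ lt = s≤s⁻¹ (subst (suc (2 * H) ≤_) (+-suc u 1) lt)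
  ... | inj₂ eq = contradiction (trans (sym u%3≡0) (trans (cong (_% 3) u≡) ([m+kn]%n≡m%n 2 (4 * k + 2) 3))) λ ()
    where
    u≡ : u ≡ 2 + (4 * k + 2) * 3
    u≡ = +-cancelʳ-≡ 2 u _ (trans (sym eq) (identity k))
      where identity : ∀ k → 2 * suc (suc (3 + 6 * k)) ≡ 2 + (4 * k + 2) * 3 + 2
            identity = solve-∀

  inRow⇒at : ∀ {u w} → w < H → InRow u w → LatticeAt u w
  inRow⇒at {u} _ (start-multiple refl u%3≡0) =
    mkLatticeAt {u} {0} 0 0 refl z≤n (λ y column → ≤-reflexive (trans (cong (_% 3) (+-cancelʳ-≡ 0 y u column)) u%3≡0))
  inRow⇒at {u} _ (start-full refl full) = mkLatticeAt {u} {0} 2 H refl full (λ y _ → residue-small {y} (s≤s (s≤s z≤n)))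
  inRow⇒at {u} {w} w<H (odd w-odd bound exception) with odd-below-H w-odd w<H
  ... | e , w+2d≡H = mkLatticeAt {u} {w} 1 (suc e) (trans w+2d≡H (sym (+-identityʳ H))) fits (residue-ok e w+2d≡H)
    where
    fits : 2 * suc e ≤ u + 1
    fits = +-cancelˡ-≤ w _ _ (subst₂ _≤_ (sym w+2d≡H) (+-assoc w u 1) bound)
    residue-ok : ∀ e → w + 2 * suc e ≡ H → ∀ y → y + 2 * suc e ≡ u + 1 → y % 3 ≤ suc e
    residue-ok (suc _) _ y _ = residue-small {y} (s≤s (s≤s z≤n))
    residue-ok zero w+2≡H y column with y % 3 in y%3 | residue≤2 y
    ... | 0 | _ = z≤n
    ... | 1 | _ = s≤s z≤n
    ... | suc (suc (suc _)) | s≤s (s≤s ())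
    ... | 2 | _ = contradiction u%3≡0 (exception (+-cancelʳ-≡ 2 w H₋₂ (trans w+2≡H (+-comm 2 H₋₂))))
      where
      u≡1+y : u ≡ suc y
      u≡1+y = +-cancelʳ-≡ 1 u (suc y) (trans (sym column) (+-suc y 1))
      u%3≡0 : u % 3 ≡ 0
      u%3≡0 = trans (cong (_% 3) u≡1+y) (trans (%-distribˡ-+ 1 y 3) (cong (λ r → (1 + r) % 3) y%3))
  inRow⇒at {u} _ (odd-full refl full u%3≡0) =
    mkLatticeAt {u} {H₋₂} 3 (suc H) (identity H₋₂) fits (λ y _ → residue-small {y} (s≤s (s≤s z≤n)))
    where
    identity : ∀ h → h + 2 * suc (suc (suc h)) ≡ 3 * suc (suc h)
    identity = solve-∀
    fits : 2 * suc H ≤ u + 3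
    fits = begin
      2 * suc H      ≡⟨ *-suc 2 H ⟩
      2 + 2 * H      ≤⟨ +-monoʳ-≤ 2 (full-row-strict u%3≡0 full) ⟩
      2 + (u + 1)    ≡⟨ +-comm 2 (u + 1) ⟩
      u + 1 + 2      ≡⟨ +-assoc u 1 2 ⟩
      u + 3          ∎
      where open ≤-Reasoning
  inRow⇒at {u} {w} w<H (even w-even _ bound) with even-below-H w-even w<H
  ... | d , w+2d≡2H = mkLatticeAt {u} {w} 2 d w+2d≡2H fits (λ y _ → residue-small {y} (two≤d {w} {0} {d} w<H w+2d≡2H))
    where
    fits : 2 * d ≤ u + 2
    fits = +-cancelˡ-≤ w _ _ (subst₂ _≤_ (sym w+2d≡2H) (+-assoc w u 2) bound)

  inRow⇒⟨⟩ : ∀ {u w} → w < H → InRow u w → G (u * H + w)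
  inRow⇒⟨⟩ w<H row = lattice⇒⟨⟩ (at⇒lattice (inRow⇒at w<H row))

  viewAt : ℕ → ℕ → View
  viewAt u w = view (u % 6) (w % 6) (H ≤ᵇ w + u + 1) (2 * H ≤ᵇ w + u + 2) (H ≤ᵇ u + 1) (2 * H ≤ᵇ u + 2)
                    (w ≡ᵇ 0) (w ≡ᵇ H₋₂) (w ≡ᵇ suc H₋₂)

  inRow⇔member-start : ∀ {u} → InRow u 0 ⇔ T (member (viewAt u 0))
  inRow⇔member-start {u} = mk⇔ to from
    where
    to : InRow u 0 → T (member (viewAt u 0))
    to (start-multiple _ u%3≡0) = Equivalence.from T-∨ (inj₁ (≡⇒≡ᵇ _ _ (trans (%6%3 u) u%3≡0)))
    to (start-full _ full)       = Equivalence.from T-∨ (inj₂ (≤⇒≤ᵇ full))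
    to (odd () _ _)
    to (odd-full () _ _)
    to (even _ () _)
    from : T (member (viewAt u 0)) → InRow u 0
    from t with Equivalence.to T-∨ t
    ... | inj₁ m3 = start-multiple refl (trans (sym (%6%3 u)) (≡ᵇ⇒≡ _ _ m3))
    ... | inj₂ rb = start-full refl (≤ᵇ⇒≤ _ _ rb)

  inRow⇔member-inner : ∀ {u w} → InRow u (suc w) ⇔ T (member (viewAt u (suc w)))
  inRow⇔member-inner {u} {w′} with suc w′ % 6 % 2 ≡ᵇ 1 in condition | parity (suc w′)
  ... | true  | inj₂ w-odd = mk⇔ to from
    where
    w = suc w′
    to : InRow u w → T (((H ≤ᵇ w + u + 1) ∧ not ((w ≡ᵇ H₋₂) ∧ (u % 6 % 3 ≡ᵇ 0))) ∨ (2 * H ≤ᵇ u + 2))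
    to (odd _ bound exception) = Equivalence.from T-∨ (inj₁ (Equivalence.from T-∧ (≤⇒≤ᵇ bound ,
      Equivalence.from T-not-∧ λ at m3 → exception (≡ᵇ⇒≡ _ _ at) (trans (sym (%6%3 u)) (≡ᵇ⇒≡ _ _ m3)))))
    to (odd-full _ full _) = Equivalence.from T-∨ (inj₂ (≤⇒≤ᵇ full))
    to (even w-even _ _)   = contradiction (trans (sym w-even) w-odd) λ ()
    from : T (((H ≤ᵇ w + u + 1) ∧ not ((w ≡ᵇ H₋₂) ∧ (u % 6 % 3 ≡ᵇ 0))) ∨ (2 * H ≤ᵇ u + 2)) → InRow u w
    from t with Equivalence.to T-∨ t
    ... | inj₂ rb = full-row⇒inRow (≤ᵇ⇒≤ _ _ rb)
    ... | inj₁ t′ with Equivalence.to T-∧ t′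
    ...   | bound , ¬h2∧m3 = odd w-odd (≤ᵇ⇒≤ _ _ bound) λ w≡H₋₂ u%3≡0 →
              Equivalence.to T-not-∧ ¬h2∧m3 (≡⇒≡ᵇ _ _ w≡H₋₂) (≡⇒≡ᵇ _ _ (trans (%6%3 u) u%3≡0))
  ... | false | inj₁ w-even = mk⇔ to from
    where
    w = suc w′
    to : InRow u w → T (2 * H ≤ᵇ w + u + 2)
    to (odd w-odd _ _)      = contradiction (trans (sym w-even) w-odd) λ ()
    to (odd-full refl _ _)  = contradiction (trans (sym w-even) H₋₂-odd) λ ()
    to (even _ _ bound)     = ≤⇒≤ᵇ bound
    from : T (2 * H ≤ᵇ w + u + 2) → InRow u w
    from t = even w-even (s≤s z≤n) (≤ᵇ⇒≤ _ _ t)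
  ... | true  | inj₁ w-even =
    contradiction (trans (sym (trans (%6%2 (suc w′)) w-even)) (≡ᵇ⇒≡ _ _ (subst T (sym condition) tt))) λ ()
  ... | false | inj₂ w-odd  = contradiction (subst T condition (≡⇒≡ᵇ _ _ (trans (%6%2 (suc w′)) w-odd))) λ ()

  inRow⇔member : ∀ {u w} → InRow u w ⇔ T (member (viewAt u w))
  inRow⇔member {w = zero}  = inRow⇔member-start
  inRow⇔member {w = suc _} = inRow⇔member-inner

  member-viewAt : ∀ {u w} → w < H → G (u * H + w) ⇔ T (member (viewAt u w))
  member-viewAt w<H = mk⇔
    (λ g → Equivalence.to inRow⇔member (at⇒inRow w<H (lattice⇒at (⟨⟩⇒lattice g))))
    (λ t → lattice⇒⟨⟩ (at⇒lattice (inRow⇒at w<H (Equivalence.from inRow⇔member t))))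

  by-rows : ∀ x → x ≡ x / H * H + x % H
  by-rows x = trans (m≡m%n+[m/n]*n x H) (+-comm (x % H) _)

  G? : Decidable G
  G? x = map′ (λ t → subst G (sym (by-rows x)) (Equivalence.from (member-viewAt (m%n<n x H)) t))
              (λ g → Equivalence.to (member-viewAt (m%n<n x H)) (subst G (by-rows x) g))
              (T? (member (viewAt (x / H) (x % H))))

  does-G? : ∀ {u w} → w < H → does (G? (u * H + w)) ≡ member (viewAt u w)
  does-G? w<H = does-≡ (G? _) (member-viewAt w<H)

  residue-viewAt : ∀ u w → (u * H + w) % 3 ≡ residue (viewAt u w)
  residue-viewAt u w = trans (cong (_% 3) split) ([m+kn]%n≡m%n (2 * (u % 6) + w % 6) quotient 3)
    where
    quotient = u % 6 + 2 * k * (u % 6) + 10 * (u / 6) + 12 * k * (u / 6) + 2 * (w / 6)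
    identity : ∀ k r q s p → (r + q * 6) * suc (suc (3 + 6 * k)) + (s + p * 6) ≡
                2 * r + s + (r + 2 * k * r + 10 * q + 12 * k * q + 2 * p) * 3
    identity = solve-∀
    split : u * H + w ≡ 2 * (u % 6) + w % 6 + quotient * 3
    split = trans (cong₂ (λ u′ w′ → u′ * H + w′) (m≡m%n+[m/n]*n u 6) (m≡m%n+[m/n]*n w 6))
                  (identity k (u % 6) (u / 6) (w % 6) (w / 6))

  H₋₂%6 : H₋₂ % 6 ≡ 3
  H₋₂%6 = %6-offset 3 k (s≤s (s≤s (s≤s (s≤s z≤n))))

  H₋₁%6 : suc H₋₂ % 6 ≡ 4
  H₋₁%6 = %6-offset 4 k (s≤s (s≤s (s≤s (s≤s (s≤s z≤n)))))

  H%6 : H % 6 ≡ 5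
  H%6 = %6-offset 5 k ≤-refl

  2H%6 : (2 * H) % 6 ≡ 4
  2H%6 = trans (cong (_% 6) (identity k)) (%6-offset 4 (2 * k + 1) (s≤s (s≤s (s≤s (s≤s (s≤s z≤n))))))
    where identity : ∀ k → 2 * (5 + 6 * k) ≡ 4 + 6 * (2 * k + 1)
          identity = solve-∀

  late-column⇒odd-on : ∀ {u w} → 1 ≤ u → H₋₂ ≤ w → H ≤ w + u + 1
  late-column⇒odd-on {u} {w} 1≤u H₋₂≤w =
    subst (_≤ w + u + 1) (identity H₋₂) (+-monoˡ-≤ 1 (+-mono-≤ H₋₂≤w 1≤u))
    where identity : ∀ h → h + 1 + 1 ≡ suc (suc h)
          identity = solve-∀

  last-column-even⇔row-odd : ∀ {u} → 2 * H ≤ suc H₋₂ + u + 2 ⇔ H ≤ u + 1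
  last-column-even⇔row-odd {u} = mk⇔ (λ le → +-cancelˡ-≤ H _ _ (subst₂ _≤_ 2H≡ shift le))
                              (λ le → subst₂ _≤_ (sym 2H≡) (sym shift) (+-monoʳ-≤ H le))
    where
    2H≡ : 2 * H ≡ H + H
    2H≡ = cong (H +_) (+-identityʳ H)
    shift : suc H₋₂ + u + 2 ≡ H + (u + 1)
    shift = identity H₋₂ u
      where identity : ∀ h u → suc h + u + 2 ≡ suc (suc h) + (u + 1)
            identity = solve-∀

  coherent-viewAt : ∀ {u w} → 1 ≤ u → T (coherent (viewAt u w))
  coherent-viewAt {u} {w} 1≤u = coherent-intro (viewAt u w)
    (⇒ᵇ-intro λ z → subst (λ v → T (v % 6 ≡ᵇ 0)) (sym (≡ᵇ⇒≡ w 0 z)) tt)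
    (⇒ᵇ-intro λ h1 → subst (λ v → T (v % 6 ≡ᵇ 4)) (sym (≡ᵇ⇒≡ w _ h1)) (≡⇒≡ᵇ _ _ H₋₁%6))
    (Equivalence.from T-not-∧ λ h2 h1 → 1+n≢n (trans (sym (≡ᵇ⇒≡ w _ h1)) (≡ᵇ⇒≡ w _ h2)))
    (⇒ᵇ-intro λ f2 → ≤⇒≤ᵇ (full⇒H≤u+1 {w + u} (≤ᵇ⇒≤ _ _ f2)))
    (⇒ᵇ-intro {2 * H ≤ᵇ u + 2} λ rb → _&_ {H ≤ᵇ u + 1} (≤⇒≤ᵇ (full⇒H≤u+1 {u} (≤ᵇ⇒≤ _ _ rb)))
                                                     (≤⇒≤ᵇ (≤-trans (≤ᵇ⇒≤ _ _ rb) (≤-shift w u 2))))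
    (⇒ᵇ-intro λ late → ≤⇒≤ᵇ (late-column⇒odd-on 1≤u (late-column late)))
    (⇒ᵇ-intro λ z → subst (λ v → T (((H ≤ᵇ v + u + 1) ⇔ᵇ (H ≤ᵇ u + 1)) ∧ ((2 * H ≤ᵇ v + u + 2) ⇔ᵇ (2 * H ≤ᵇ u + 2))))
                          (sym (≡ᵇ⇒≡ w 0 z)) (⇔ᵇ-refl (H ≤ᵇ u + 1) & ⇔ᵇ-refl (2 * H ≤ᵇ u + 2)))
    (⇒ᵇ-intro λ h1 → subst (λ v → T ((2 * H ≤ᵇ v + u + 2) ⇔ᵇ (H ≤ᵇ u + 1))) (sym (≡ᵇ⇒≡ w _ h1))
                           (⇔ᵇ-intro (λ t → ≤⇒≤ᵇ (Equivalence.to last-column-even⇔row-odd (≤ᵇ⇒≤ _ _ t)))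
                                     (λ t → ≤⇒≤ᵇ (Equivalence.from last-column-even⇔row-odd (≤ᵇ⇒≤ _ _ t)))))
    where
    late-column : T ((w ≡ᵇ H₋₂) ∨ (w ≡ᵇ suc H₋₂)) → H₋₂ ≤ w
    late-column t with Equivalence.to T-∨ t
    ... | inj₁ h2 = ≤-reflexive (sym (≡ᵇ⇒≡ w _ h2))
    ... | inj₂ h1 = ≤-trans (n≤1+n H₋₂) (≤-reflexive (sym (≡ᵇ⇒≡ w _ h1)))

  cellMove-viewAt : ∀ {u w} → T (cellMove (viewAt u w) (viewAt u (suc w)))
  cellMove-viewAt {u} {w} = cellMove-intro (viewAt u w) (viewAt u (suc w))
    (⇒ᵇ-intro λ t → ≤⇒≤ᵇ (m≤n⇒m≤1+n (≤ᵇ⇒≤ H (w + u + 1) t)))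
    (⇒ᵇ-intro {(H ≤ᵇ suc w + u + 1) ∧ not (H ≤ᵇ w + u + 1)} λ t → let on , off = Equivalence.to T-∧ t in
      ≡⇒≡ᵇ _ _ (trans (mod6-sum (suc w) u 1) (trans (cong (_% 6) (sym (threshold {H} {w + u + 1} on off))) H%6)))
    (⇒ᵇ-intro λ t → ≤⇒≤ᵇ (m≤n⇒m≤1+n (≤ᵇ⇒≤ (2 * H) (w + u + 2) t)))
    (⇒ᵇ-intro {(2 * H ≤ᵇ suc w + u + 2) ∧ not (2 * H ≤ᵇ w + u + 2)} λ t → let on , off = Equivalence.to T-∧ t in
      ≡⇒≡ᵇ _ _ (trans (mod6-sum (suc w) u 2) (trans (cong (_% 6) (sym (threshold {2 * H} {w + u + 2} on off))) 2H%6)))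
    (⇒ᵇ-intro λ h2 → subst (λ v → T (v % 6 ≡ᵇ 3)) (sym (≡ᵇ⇒≡ (suc w) H₋₂ h2)) (≡⇒≡ᵇ (H₋₂ % 6) 3 H₋₂%6))

  rowMove-viewAt : ∀ {u w} → T (rowMove (viewAt u w) (viewAt (suc u) 0))
  rowMove-viewAt {u} {w} = rowMove-intro (viewAt u w) (viewAt (suc u) 0)
    (⇒ᵇ-intro λ t → ≤⇒≤ᵇ (m≤n⇒m≤1+n (≤ᵇ⇒≤ H (u + 1) t)))
    (⇒ᵇ-intro {(H ≤ᵇ suc u + 1) ∧ not (H ≤ᵇ u + 1)} λ t → let on , off = Equivalence.to T-∧ t in
      ≡⇒≡ᵇ _ _ (trans (cong (_% 6) (u≡H₋₂ (threshold {H} {u + 1} on off))) H₋₂%6))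
    (⇒ᵇ-intro λ t → ≤⇒≤ᵇ (m≤n⇒m≤1+n (≤ᵇ⇒≤ (2 * H) (u + 2) t)))
    (⇒ᵇ-intro {(2 * H ≤ᵇ suc u + 2) ∧ not (2 * H ≤ᵇ u + 2)} λ t → let on , off = Equivalence.to T-∧ t in
      ≡⇒≡ᵇ _ _ (trans (cong (_% 6) (u≡ (threshold {2 * H} {u + 2} on off))) (%6-offset 1 (2 * k + 1) (s≤s (s≤s z≤n)))))
    where
    u≡H₋₂ : H ≡ suc (u + 1) → u ≡ H₋₂
    u≡H₋₂ eq = +-cancelʳ-≡ 1 u H₋₂ (trans (suc-injective (sym eq)) (+-comm 1 H₋₂))
    u≡ : 2 * H ≡ suc (u + 2) → u ≡ 1 + 6 * (2 * k + 1)
    u≡ eq = +-cancelʳ-≡ 3 u _ (trans (+-suc u 2) (trans (sym eq) (identity k)))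
      where identity : ∀ k → 2 * suc (suc (3 + 6 * k)) ≡ 1 + 6 * (2 * k + 1) + 3
            identity = solve-∀

  viewAt-suc : ∀ {u w} →
    viewAt u (suc w) ≡ nextCell (viewAt u w) (H ≤ᵇ suc w + u + 1) (2 * H ≤ᵇ suc w + u + 2) (suc w ≡ᵇ H₋₂)
  viewAt-suc {u} {w} = cong (λ j → view (u % 6) j (H ≤ᵇ suc w + u + 1) (2 * H ≤ᵇ suc w + u + 2)
                                          (H ≤ᵇ u + 1) (2 * H ≤ᵇ u + 2) false (suc w ≡ᵇ H₋₂) (w ≡ᵇ H₋₂))
                            (%-distribˡ-+ 1 w 6)

  viewAt-next-row : ∀ {u w} → viewAt (suc u) 0 ≡ nextRow (viewAt u w) (H ≤ᵇ suc u + 1) (2 * H ≤ᵇ suc u + 2)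
  viewAt-next-row {u} = cong (λ i → view i 0 (H ≤ᵇ suc u + 1) (2 * H ≤ᵇ suc u + 2) (H ≤ᵇ suc u + 1)
                                        (2 * H ≤ᵇ suc u + 2) true false false)
                             (%-distribˡ-+ 1 u 6)

  gap : ℕ
  gap = 12 * k + 7

  G-step : ∀ x → G x → G (x + suc gap)
  G-step x gx = subst G (trans (+-comm a x) (cong (x +_) (+-suc (12 * k) 7))) (gen-add (here refl) gx)

  open Enumeration G? gap G-step gen-zero

  a≤generator : ∀ {g} → g ∈ gens → a ≤ g
  a≤generator (here refl)                 = ≤-refl
  a≤generator (there (here refl))         = ≤-trans (m≤m+n a (a / 2)) (m≤m+n (a + a / 2) 1)
  a≤generator (there (there (here refl))) = ≤-trans (m≤m+n a (a / 2)) (m≤m+n (a + a / 2) 3)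

  zero-or-≥a : ∀ {x} → G x → x ≡ 0 ⊎ a ≤ x
  zero-or-≥a gen-zero                = inj₁ refl
  zero-or-≥a (gen-add {g} {x} g∈ _) = inj₂ (≤-trans (a≤generator g∈) (m≤m+n g x))

  H<a : H < a
  H<a = subst (H <_) (identity k) (m≤m+n (suc H) (6 * k + 2))
    where identity : ∀ k → suc (suc (suc (3 + 6 * k))) + (6 * k + 2) ≡ 12 * k + 8
          identity = solve-∀

  scan-below-a : ∀ x → x < a → scan x ≡ just []
  scan-below-a zero    _   = refl
  scan-below-a (suc x) x<a = trans (scan-skip x ¬G) (scan-below-a x (<-trans (n<1+n x) x<a))
    where
    ¬G : ¬ G (suc x)
    ¬G g with zero-or-≥a g
    ... | inj₂ a≤ = <-irrefl refl (<-≤-trans x<a a≤)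

  scan-cell : ∀ {u w} → 1 ≤ u → suc w < H → scan (u * H + w) ≡ just (state (viewAt u w)) →
              scan (u * H + suc w) ≡ just (state (viewAt u (suc w)))
  scan-cell {u} {w} 1≤u sw<H at-w =
    trans (cong scan (+-suc (u * H) w)) (trans (scan-suc {u * H + w} at-w membership residue′) steps)
    where
    shift = sym (+-suc (u * H) w)
    membership : does (G? (suc (u * H + w))) ≡ member (viewAt u (suc w))
    membership = trans (cong (λ x → does (G? x)) shift) (does-G? sw<H)
    residue′ : suc (u * H + w) % 3 ≡ residue (viewAt u (suc w))
    residue′ = trans (cong (_% 3) shift) (residue-viewAt u (suc w))
    not-last : T (not (w ≡ᵇ suc H₋₂))
    not-last = Equivalence.from T-not λ t → <-irrefl (cong suc (≡ᵇ⇒≡ w _ t)) sw<H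
    steps : Steps (viewAt u w) (viewAt u (suc w))
    steps = subst (Steps (viewAt u w)) (sym (viewAt-suc {u} {w}))
      (cell-step (viewAt u w) (H ≤ᵇ suc w + u + 1) (2 * H ≤ᵇ suc w + u + 2) (suc w ≡ᵇ H₋₂)
        (m%n<n u 6) (m%n<n w 6) not-last (coherent-viewAt {u} {w} 1≤u)
        (subst (λ v → T (coherent v)) (viewAt-suc {u} {w}) (coherent-viewAt {u} {suc w} 1≤u))
        (subst (λ v → T (cellMove (viewAt u w) v)) (viewAt-suc {u} {w}) (cellMove-viewAt {u} {w})))

  scan-row : ∀ {u} → 1 ≤ u → scan (u * H + suc H₋₂) ≡ just (state (viewAt u (suc H₋₂))) →
             scan (suc u * H + 0) ≡ just (state (viewAt (suc u) 0))
  scan-row {u} 1≤u at-end =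
    trans (cong scan (sym shift)) (trans (scan-suc {u * H + suc H₋₂} at-end membership residue′) steps)
    where
    v = viewAt u (suc H₋₂)
    shift : suc (u * H + suc H₋₂) ≡ suc u * H + 0
    shift = identity (u * H) H₋₂
      where identity : ∀ x h → suc (x + suc h) ≡ suc (suc h) + x + 0
            identity = solve-∀
    membership : does (G? (suc (u * H + suc H₋₂))) ≡ member (viewAt (suc u) 0)
    membership = trans (cong (λ x → does (G? x)) shift) (does-G? {suc u} {0} (s≤s z≤n))
    residue′ : suc (u * H + suc H₋₂) % 3 ≡ residue (viewAt (suc u) 0)
    residue′ = trans (cong (_% 3) shift) (residue-viewAt (suc u) 0)
    steps : Steps v (viewAt (suc u) 0)
    steps = subst (Steps v) (sym (viewAt-next-row {u} {suc H₋₂}))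
      (row-step v (H ≤ᵇ suc u + 1) (2 * H ≤ᵇ suc u + 2) (m%n<n u 6) (m%n<n (suc H₋₂) 6)
        (≡⇒≡ᵇ (suc H₋₂) (suc H₋₂) refl) (coherent-viewAt {u} {suc H₋₂} 1≤u)
        (subst (λ v′ → T (coherent v′)) (viewAt-next-row {u} {suc H₋₂}) (coherent-viewAt {suc u} {0} (s≤s z≤n)))
        (rowMove-viewAt {u} {suc H₋₂}))

  scan-viewAt : ∀ u w → 1 ≤ u → w < H → scan (u * H + w) ≡ just (state (viewAt u w))
  scan-viewAt (suc zero) zero _ _ =
    scan-below-a (1 * H + 0) (subst (_< a) (sym (trans (+-identityʳ (1 * H)) (*-identityˡ H))) H<a)
  scan-viewAt (suc (suc u)) zero _ _ =
    scan-row {suc u} (s≤s z≤n) (scan-viewAt (suc u) (suc H₋₂) (s≤s z≤n) ≤-refl)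
  scan-viewAt u (suc w) 1≤u w<H =
    scan-cell 1≤u w<H (scan-viewAt u w 1≤u (<-trans (n<1+n w) w<H))

  scan-rows : ∀ x → H ≤ x → scan (x / H * H + x % H) ≡ just (state (viewAt (x / H) (x % H)))
  scan-rows x H≤x = scan-viewAt (x / H) (x % H) (m≥n⇒m/n>0 H≤x) (m%n<n x H)

  scan-just : ∀ x → ∃[ s ] scan x ≡ just s
  scan-just x = case x <? H of λ
    { (yes x<H) → [] , scan-below-a x (<-trans x<H H<a)
    ; (no  x≮H) → _ , trans (cong scan (by-rows x)) (scan-rows x (≮⇒≥ x≮H)) }

  never-stuck : ∀ x → scan x ≢ nothing
  never-stuck x stuck = just≢nothing (trans (sym (proj₂ (scan-just x))) stuck)

  closed : ∀ {x y} → G x → G y → G (x + y)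
  closed gen-zero gy = gy
  closed (gen-add {g} {x} g∈ gx) gy = subst G (sym (+-assoc g x _)) (gen-add g∈ (closed gx gy))

  cofinite : ∃[ N ] (∀ m → N ≤ m → G m)
  cofinite = 2 * H * H , λ m N≤m →
    subst G (sym (by-rows m)) (inRow⇒⟨⟩ (m%n<n m H) (full-row⇒inRow (full m N≤m)))
    where
    full : ∀ m → 2 * H * H ≤ m → 2 * H ≤ m / H + 2
    full m N≤m = ≤-trans (subst (_≤ m / H) (m*n/n≡m (2 * H) H) (/-monoˡ-≤ H N≤m)) (m≤m+n (m / H) 2)

  numerical : IsNumericalSemigroup G
  numerical = record { has-zero = gen-zero ; closed-add = closed ; cofinite = cofinite }

  generator : ∀ {g} → g ∈ gens → G g
  generator {g} g∈ = subst G (+-identityʳ g) (gen-add g∈ gen-zero)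

  a<b : a < b
  a<b = subst (suc a ≤_) (+-comm 1 (a + a / 2)) (s≤s (m≤m+n a (a / 2)))

  b<c : b < c
  b<c = +-monoʳ-< (a + a / 2) (s≤s (s≤s z≤n))

  c<2a : c < a + a
  c<2a = subst₂ _≤_ (cong suc (sym c≡3H)) (identity k) (m≤m+n (suc (3 * H)) (6 * k))
    where identity : ∀ k → suc (3 * suc (suc (3 + 6 * k))) + 6 * k ≡ 12 * k + 8 + (12 * k + 8)
          identity = solve-∀

  below-2a : ∀ {z} → G z → z < a + a → z ≡ 0 ⊎ z ≡ a ⊎ z ≡ b ⊎ z ≡ c
  below-2a gen-zero _ = inj₁ refl
  below-2a (gen-add {g} {x} g∈ gx) z<2a with zero-or-≥a gx
  ... | inj₂ a≤x = contradiction z<2a (≤⇒≯ (+-mono-≤ (a≤generator g∈) a≤x))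
  ... | inj₁ refl with g∈
  ...   | here refl                 = inj₂ (inj₁ (+-identityʳ a))
  ...   | there (here refl)         = inj₂ (inj₂ (inj₁ (+-identityʳ b)))
  ...   | there (there (here refl)) = inj₂ (inj₂ (inj₂ (+-identityʳ c)))

  enum-1 : enum 1 ≡ a
  enum-1 = enum-suc-unique 0
    record { member = generator (here refl) ; above = subst (0 <_) (sym (+-suc (12 * k) 7)) (s≤s z≤n) ; skips = skips }
    where
    skips : ∀ z → 0 < z → z < a → ¬ G z
    skips z 0<z z<a gz with zero-or-≥a gz
    ... | inj₁ refl = <-irrefl refl 0<z
    ... | inj₂ a≤z  = <-irrefl refl (<-≤-trans z<a a≤z)

  enum-2 : enum 2 ≡ b
  enum-2 = enum-suc-unique 1 (subst (λ p → IsNext p b) (sym enum-1)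
    record { member = generator (there (here refl)) ; above = a<b ; skips = skips })
    where
    skips : ∀ z → a < z → z < b → ¬ G z
    skips z a<z z<b gz = case below-2a gz (<-trans z<b (<-trans b<c c<2a)) of λ
      { (inj₁ z≡0)               → contradiction (subst (a <_) z≡0 a<z) λ ()
      ; (inj₂ (inj₁ z≡a))        → <-irrefl (sym z≡a) a<z
      ; (inj₂ (inj₂ (inj₁ z≡b))) → <-irrefl z≡b z<b
      ; (inj₂ (inj₂ (inj₂ z≡c))) → <-asym (subst (_< b) z≡c z<b) b<c }

  enum-3 : enum 3 ≡ c
  enum-3 = enum-suc-unique 2 (subst (λ p → IsNext p c) (sym enum-2)
    record { member = generator (there (there (here refl))) ; above = b<c ; skips = skips })
    where
    skips : ∀ z → b < z → z < c → ¬ G z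
    skips z b<z z<c gz = case below-2a gz (<-trans z<c c<2a) of λ
      { (inj₁ z≡0)               → contradiction (subst (b <_) z≡0 b<z) λ ()
      ; (inj₂ (inj₁ z≡a))        → <-asym (subst (b <_) z≡a b<z) a<b
      ; (inj₂ (inj₂ (inj₁ z≡b))) → <-irrefl (sym z≡b) b<z
      ; (inj₂ (inj₂ (inj₂ z≡c))) → <-irrefl z≡c z<c }

  permutation : IsPermutationNS 3 G
  permutation = numerical , enum , enumerates , generated , blocks-permute-residues never-stuck
    where
    first-three : tabulate {n = 3} (λ j → enum (suc (toℕ j))) ≡ gens
    first-three = cong₂ _∷_ enum-1 (cong₂ _∷_ enum-2 (cong₂ _∷_ enum-3 refl))
    generated : ∀ x → G x ⇔ ⟨ tabulate {n = 3} (λ j → enum (suc (toℕ j))) ⟩ x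
    generated x = mk⇔ (subst (λ l → ⟨ l ⟩ x) (sym first-three)) (subst (λ l → ⟨ l ⟩ x) first-three)

lemma4p16 : (k : ℕ) → 1 ≤ k →
    let a = 12 * k + 8
        b = a + a / 2 + 1
        c = a + a / 2 + 3
    in (∀ x → ⟨ a ∷ b ∷ c ∷ [] ⟩ x ⇔
          (∃[ q ] ∃[ r ] ∃[ s ] (r ≤ q × x ≡ (s + q) * a + q * (a / 2) + q + 2 * r)))
       × IsPermutationNS 3 ⟨ a ∷ b ∷ c ∷ [] ⟩
lemma4p16 k _ = (λ _ → mk⇔ ⟨⟩⇒paper paper⇒⟨⟩) , permutation
  where open Semigroup k
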